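{- Let $(\mathcal{H},m,u,\Delta,\varepsilon,S)$ be a connected filtered Hopf algebra over a field $k$ of characteristic zero, with reduced coproduct $\widetilde{\Delta}(x)=\Delta(x)-1\otimes x-x\otimes 1$ for $x\in\ker\varepsilon$. Let $N\subseteq\mathcal{H}$ be a linear subspace with $\varepsilon(N)=\{0\}$ and $\widetilde{\Delta}(N)\subseteq N\otimes\mathcal{H}$. Let $\mathcal{A}$ be a commutative unital $k$-algebra and let $G_{\mathcal{A}}$ be the group of unital algebra morphisms $\mathcal{H}\to\mathcal{A}$ under the convolution product $\phi\star\psi=m_{\mathcal{A}}\circ(\phi\otimes\psi)\circ\Delta$, with unit $e=u_{\mathcal{A}}\circ\varepsilon$ and inverse $\phi^{ -1}=\phi\circ S$. Then $$T_{\mathcal{A}}:=\{\phi\in G_{\mathcal{A}}:\ \phi|_N=0\}$$ is a subgroup of $(G_{\mathcal{A}},\star,e)$.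
   Context: The antipode of a connected filtered Hopf algebra satisfies $S(x)=-x-\sum_{(x)}x'S(x'')$ for $x\in\ker\varepsilon$, where $\widetilde\Delta(x)=\sum_{(x)}x'\otimes x''$ (Sweedler notation). -}

module Defs where

open import Level using (Level; _⊔_; suc)
open import Algebra.Bundles using (CommutativeRing)
open import Algebra.Module.Bundles using (Module)
open import Data.Nat as ℕ using (ℕ; zero)
open import Data.List using (List; []; _∷_; [_]; _++_; map; foldr; concatMap)
open import Data.List.Relation.Unary.All using (All)
open import Data.Product using (Σ; _×_; _,_; proj₁; proj₂; ∃)
open import Relation.Binary.PropositionalEquality using (_≡_)
open import Relation.Nullary using (¬_)

record Field c ℓ : Set (suc (c ⊔ ℓ)) where
  field
    commutativeRing : CommutativeRing c ℓ
  open CommutativeRing commutativeRing public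
  field
    1≉0     : ¬ (1# ≈ 0#)
    inverse : ∀ x → ¬ (x ≈ 0#) → Σ Carrier (λ y → (x * y) ≈ 1#)

  _×1 : ℕ → Carrier
  zero ×1    = 0#
  ℕ.suc n ×1 = 1# + (n ×1)

CharacteristicZero : ∀ {c ℓ} → Field c ℓ → Set ℓ
CharacteristicZero K = ∀ n → (n ×1) ≈ 0# → n ≡ 0
  where open Field K

module Over {c ℓ} (K : Field c ℓ) where
  open Field K

  VectorSpace : (m ℓm : Level) → Set (c ⊔ ℓ ⊔ suc (m ⊔ ℓm))
  VectorSpace m ℓm = Module commutativeRing m ℓm

  -- Tensor products V ⊗ V and V ⊗ V ⊗ V, as formal sums of pure
  -- tensors modulo the congruence generated by the defining
  -- (bilinearity / balancing) relations. Scalars are absorbed into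
  -- the first factor, sums are concatenation.

  module Tensor {m ℓm} (V : VectorSpace m ℓm) where
    open Module V

    Tensor₂ : Set m
    Tensor₂ = List (Carrierᴹ × Carrierᴹ)

    infix 4 _∼₂_
    data _∼₂_ : Tensor₂ → Tensor₂ → Set (c ⊔ m ⊔ ℓm) where
      ∼-refl  : ∀ {s} → s ∼₂ s
      ∼-sym   : ∀ {s t} → s ∼₂ t → t ∼₂ s
      ∼-trans : ∀ {s t u} → s ∼₂ t → t ∼₂ u → s ∼₂ u
      ∼-++    : ∀ {s s′ t t′} → s ∼₂ s′ → t ∼₂ t′ → (s ++ t) ∼₂ (s′ ++ t′)
      ∼-swap  : ∀ {s t} → (s ++ t) ∼₂ (t ++ s)
      ∼-≈     : ∀ {x x′ y y′} → x ≈ᴹ x′ → y ≈ᴹ y′ → [ (x , y) ] ∼₂ [ (x′ , y′) ]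
      ∼-+ˡ    : ∀ {x x′ y} → [ (x +ᴹ x′ , y) ] ∼₂ (x , y) ∷ (x′ , y) ∷ []
      ∼-+ʳ    : ∀ {x y y′} → [ (x , y +ᴹ y′) ] ∼₂ (x , y) ∷ (x , y′) ∷ []
      ∼-0ˡ    : ∀ {y} → [ (0ᴹ , y) ] ∼₂ []
      ∼-0ʳ    : ∀ {x} → [ (x , 0ᴹ) ] ∼₂ []
      ∼-*     : ∀ {a x y} → [ (a *ₗ x , y) ] ∼₂ [ (x , a *ₗ y) ]

    Tensor₃ : Set m
    Tensor₃ = List (Carrierᴹ × Carrierᴹ × Carrierᴹ)

    infix 4 _∼₃_
    data _∼₃_ : Tensor₃ → Tensor₃ → Set (c ⊔ m ⊔ ℓm) where
      ∼-refl  : ∀ {s} → s ∼₃ s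
      ∼-sym   : ∀ {s t} → s ∼₃ t → t ∼₃ s
      ∼-trans : ∀ {s t u} → s ∼₃ t → t ∼₃ u → s ∼₃ u
      ∼-++    : ∀ {s s′ t t′} → s ∼₃ s′ → t ∼₃ t′ → (s ++ t) ∼₃ (s′ ++ t′)
      ∼-swap  : ∀ {s t} → (s ++ t) ∼₃ (t ++ s)
      ∼-≈     : ∀ {x x′ y y′ z z′} → x ≈ᴹ x′ → y ≈ᴹ y′ → z ≈ᴹ z′ →
                [ (x , y , z) ] ∼₃ [ (x′ , y′ , z′) ]
      ∼-+₁    : ∀ {x x′ y z} → [ (x +ᴹ x′ , y , z) ] ∼₃ (x , y , z) ∷ (x′ , y , z) ∷ []
      ∼-+₂    : ∀ {x y y′ z} → [ (x , y +ᴹ y′ , z) ] ∼₃ (x , y , z) ∷ (x , y′ , z) ∷ []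
      ∼-+₃    : ∀ {x y z z′} → [ (x , y , z +ᴹ z′) ] ∼₃ (x , y , z) ∷ (x , y , z′) ∷ []
      ∼-0₁    : ∀ {y z} → [ (0ᴹ , y , z) ] ∼₃ []
      ∼-0₂    : ∀ {x z} → [ (x , 0ᴹ , z) ] ∼₃ []
      ∼-0₃    : ∀ {x y} → [ (x , y , 0ᴹ) ] ∼₃ []
      ∼-*₁₂   : ∀ {a x y z} → [ (a *ₗ x , y , z) ] ∼₃ [ (x , a *ₗ y , z) ]
      ∼-*₂₃   : ∀ {a x y z} → [ (x , a *ₗ y , z) ] ∼₃ [ (x , y , a *ₗ z) ]

    sumᴹ : List Carrierᴹ → Carrierᴹ
    sumᴹ = foldr _+ᴹ_ 0ᴹ

  record KAlgebra (m ℓm : Level) : Set (c ⊔ ℓ ⊔ suc (m ⊔ ℓm)) where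
    field
      vectorSpace : VectorSpace m ℓm
    open Module vectorSpace public
    infixl 7 _·_
    field
      _·_        : Carrierᴹ → Carrierᴹ → Carrierᴹ
      1ᴬ         : Carrierᴹ
      ·-cong     : ∀ {x x′ y y′} → x ≈ᴹ x′ → y ≈ᴹ y′ → (x · y) ≈ᴹ (x′ · y′)
      ·-assoc    : ∀ x y z → ((x · y) · z) ≈ᴹ (x · (y · z))
      ·-identityˡ : ∀ x → (1ᴬ · x) ≈ᴹ x
      ·-identityʳ : ∀ x → (x · 1ᴬ) ≈ᴹ x
      ·-distribˡ : ∀ x y z → (x · (y +ᴹ z)) ≈ᴹ ((x · y) +ᴹ (x · z))
      ·-distribʳ : ∀ x y z → ((y +ᴹ z) · x) ≈ᴹ ((y · x) +ᴹ (z · x))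
      ·-*ₗˡ      : ∀ a x y → ((a *ₗ x) · y) ≈ᴹ (a *ₗ (x · y))
      ·-*ₗʳ      : ∀ a x y → (x · (a *ₗ y)) ≈ᴹ (a *ₗ (x · y))

    u : Carrier → Carrierᴹ
    u a = a *ₗ 1ᴬ

  IsCommutative : ∀ {m ℓm} → KAlgebra m ℓm → Set (m ⊔ ℓm)
  IsCommutative A = ∀ x y → (x · y) ≈ᴹ (y · x)
    where open KAlgebra A

  record HopfAlgebra (m ℓm : Level) : Set (c ⊔ ℓ ⊔ suc (m ⊔ ℓm)) where
    field
      algebra : KAlgebra m ℓm
    open KAlgebra algebra public
    open Tensor vectorSpace public
    field
      Δ       : Carrierᴹ → Tensor₂
      Δ-cong  : ∀ {x y} → x ≈ᴹ y → Δ x ∼₂ Δ y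
      Δ-+     : ∀ x y → Δ (x +ᴹ y) ∼₂ (Δ x ++ Δ y)
      Δ-*ₗ    : ∀ a x → Δ (a *ₗ x) ∼₂ map (λ pq → (a *ₗ proj₁ pq , proj₂ pq)) (Δ x)
      -- coassociativity (Δ ⊗ id) Δ = (id ⊗ Δ) Δ
      Δ-coassoc : ∀ x →
        concatMap (λ pq → map (λ rs → (proj₁ rs , proj₂ rs , proj₂ pq)) (Δ (proj₁ pq))) (Δ x)
        ∼₃ concatMap (λ pq → map (λ rs → (proj₁ pq , proj₁ rs , proj₂ rs)) (Δ (proj₂ pq))) (Δ x)
      ε       : Carrierᴹ → Carrier
      ε-cong  : ∀ {x y} → x ≈ᴹ y → ε x ≈ ε y
      ε-+     : ∀ x y → ε (x +ᴹ y) ≈ (ε x + ε y)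
      ε-*ₗ    : ∀ a x → ε (a *ₗ x) ≈ (a * ε x)
      counitˡ : ∀ x → sumᴹ (map (λ pq → ε (proj₁ pq) *ₗ proj₂ pq) (Δ x)) ≈ᴹ x
      counitʳ : ∀ x → sumᴹ (map (λ pq → ε (proj₂ pq) *ₗ proj₁ pq) (Δ x)) ≈ᴹ x
      Δ-· : ∀ x y → Δ (x · y) ∼₂
              concatMap (λ pq → map (λ rs → (proj₁ pq · proj₁ rs , proj₂ pq · proj₂ rs)) (Δ y)) (Δ x)
      Δ-1 : Δ 1ᴬ ∼₂ [ (1ᴬ , 1ᴬ) ]
      ε-· : ∀ x y → ε (x · y) ≈ (ε x * ε y)
      ε-1 : ε 1ᴬ ≈ 1#
      S       : Carrierᴹ → Carrierᴹ
      S-cong  : ∀ {x y} → x ≈ᴹ y → S x ≈ᴹ S y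
      S-+     : ∀ x y → S (x +ᴹ y) ≈ᴹ (S x +ᴹ S y)
      S-*ₗ    : ∀ a x → S (a *ₗ x) ≈ᴹ (a *ₗ S x)
      antipodeˡ : ∀ x → sumᴹ (map (λ pq → S (proj₁ pq) · proj₂ pq) (Δ x)) ≈ᴹ u (ε x)
      antipodeʳ : ∀ x → sumᴹ (map (λ pq → proj₁ pq · S (proj₂ pq)) (Δ x)) ≈ᴹ u (ε x)

    Δ̃ : Carrierᴹ → Tensor₂
    Δ̃ x = Δ x ++ ((-ᴹ 1ᴬ , x) ∷ (-ᴹ x , 1ᴬ) ∷ [])

  record IsSubspace {m ℓm p} (V : VectorSpace m ℓm)
                    (P : Module.Carrierᴹ V → Set p) : Set (c ⊔ m ⊔ ℓm ⊔ p) where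
    open Module V
    field
      resp  : ∀ {x y} → x ≈ᴹ y → P x → P y
      zero∈ : P 0ᴹ
      +∈    : ∀ {x y} → P x → P y → P (x +ᴹ y)
      *∈    : ∀ a {x} → P x → P (a *ₗ x)

  record ConnectedFiltered {m ℓm} (H : HopfAlgebra m ℓm) (p : Level)
         : Set (c ⊔ ℓ ⊔ m ⊔ ℓm ⊔ suc p) where
    open HopfAlgebra H
    field
      F        : ℕ → Carrierᴹ → Set p
      F-sub    : ∀ n → IsSubspace vectorSpace (F n)
      F-mono   : ∀ n {x} → F n x → F (ℕ.suc n) x
      F-exh    : ∀ x → ∃ λ n → F n x
      F-·      : ∀ i j {x y} → F i x → F j y → F (i ℕ.+ j) (x · y)
      F-Δ      : ∀ n {x} → F n x →
                 Σ Tensor₂ λ L →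
                   All (λ ab → Σ ℕ λ i → Σ ℕ λ j →
                          (i ℕ.+ j ≡ n) × F i (proj₁ ab) × F j (proj₂ ab)) L
                   × (Δ x ∼₂ L)
      F-S      : ∀ n {x} → F n x → F n (S x)
      connected : ∀ x → F 0 x → Σ Carrier λ a → x ≈ᴹ u a
      1∈F0     : F 0 1ᴬ

  record AlgMorphism {m ℓm a ℓa} (H : HopfAlgebra m ℓm) (A : KAlgebra a ℓa)
         : Set (c ⊔ m ⊔ ℓm ⊔ a ⊔ ℓa) where
    private
      module H = HopfAlgebra H
      module A = KAlgebra A
    field
      f      : H.Carrierᴹ → A.Carrierᴹ
      f-cong : ∀ {x y} → x H.≈ᴹ y → f x A.≈ᴹ f y
      f-+    : ∀ x y → f (x H.+ᴹ y) A.≈ᴹ (f x A.+ᴹ f y)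
      f-*ₗ   : ∀ r x → f (r H.*ₗ x) A.≈ᴹ (r A.*ₗ f x)
      f-·    : ∀ x y → f (x H.· y) A.≈ᴹ (f x A.· f y)
      f-1    : f H.1ᴬ A.≈ᴹ A.1ᴬ

  module _ {m ℓm a ℓa} (H : HopfAlgebra m ℓm) (A : KAlgebra a ℓa) where
    private
      module H = HopfAlgebra H
      module A = KAlgebra A
      module TA = Tensor A.vectorSpace

    convolution : (H.Carrierᴹ → A.Carrierᴹ) → (H.Carrierᴹ → A.Carrierᴹ) →
                  H.Carrierᴹ → A.Carrierᴹ
    convolution φ ψ x = TA.sumᴹ (map (λ pq → φ (proj₁ pq) A.· ψ (proj₂ pq)) (H.Δ x))

    convUnit : H.Carrierᴹ → A.Carrierᴹ
    convUnit x = A.u (H.ε x)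

    convInverse : (H.Carrierᴹ → A.Carrierᴹ) → H.Carrierᴹ → A.Carrierᴹ
    convInverse φ x = φ (H.S x)

    VanishesOn : ∀ {n} → (H.Carrierᴹ → Set n) → (H.Carrierᴹ → A.Carrierᴹ) → Set (m ⊔ ℓa ⊔ n)
    VanishesOn N φ = ∀ x → N x → φ x A.≈ᴹ A.0ᴹ

    InT : ∀ {n} → (H.Carrierᴹ → Set n) → AlgMorphism H A → Set (m ⊔ ℓa ⊔ n)
    InT N φ = VanishesOn N (AlgMorphism.f φ)

  ReducedCoproductInto : ∀ {m ℓm n} (H : HopfAlgebra m ℓm) →
                         (HopfAlgebra.Carrierᴹ H → Set n) → Set (c ⊔ m ⊔ ℓm ⊔ n)
  ReducedCoproductInto H N =
    ∀ x → N x → Σ Tensor₂ λ L → All (λ ab → N (proj₁ ab)) L × (Δ̃ x ∼₂ L)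
    where open HopfAlgebra H

-- On x ∈ N the coproduct is Δx = 1 ⊗ x + x ⊗ 1 + Δ̃x with Δ̃x ∈ N ⊗ H, so for a
-- linear map f vanishing on N, (m_A ∘ (f ⊗ g)) (Δx) = f(1) g(x). With g = ψ this
-- makes (φ ⋆ ψ)(x) = φ(1) ψ(x) = 0. With g = φ ∘ S the same expression equals
-- φ(Σ x′ S(x″)) = φ(u(ε x)) = 0 by the antipode axiom, and also φ(1) φ(S x) = φ(S x);
-- this is the recursion S(x) = −x − Σ x′ S(x″) read through φ.
module Submission where

open import Defs
open import Level using (_⊔_)
open import Data.Product using (_×_; _,_; proj₁; proj₂)
open import Data.List using ([]; _∷_; _++_; map)
open import Data.List.Relation.Unary.All using (All; []; _∷_)
open import Algebra.Module.Bundles using (Module)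
import Algebra.Properties.Group as GroupProperties
import Relation.Binary.Reasoning.Setoid as SetoidReasoning

module Characters {c ℓ} (K : Field c ℓ) where
  open Field K using (_≈_; 0#)
  open Over K

  module KAlgebraProperties {a ℓa} (A : KAlgebra a ℓa) where
    open KAlgebra A
    open GroupProperties +ᴹ-group using (inverseˡ-unique)
    open SetoidReasoning ≈ᴹ-setoid

    ·-zeroˡ : ∀ y → (0ᴹ · y) ≈ᴹ 0ᴹ
    ·-zeroˡ y = begin
      0ᴹ · y            ≈⟨ ·-cong (≈ᴹ-sym (*ₗ-zeroˡ 0ᴹ)) ≈ᴹ-refl ⟩
      (0# *ₗ 0ᴹ) · y    ≈⟨ ·-*ₗˡ 0# 0ᴹ y ⟩
      0# *ₗ (0ᴹ · y)    ≈⟨ *ₗ-zeroˡ _ ⟩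
      0ᴹ                ∎

    ·-zeroʳ : ∀ x → (x · 0ᴹ) ≈ᴹ 0ᴹ
    ·-zeroʳ x = begin
      x · 0ᴹ            ≈⟨ ·-cong ≈ᴹ-refl (≈ᴹ-sym (*ₗ-zeroˡ 0ᴹ)) ⟩
      x · (0# *ₗ 0ᴹ)    ≈⟨ ·-*ₗʳ 0# x 0ᴹ ⟩
      0# *ₗ (x · 0ᴹ)    ≈⟨ *ₗ-zeroˡ _ ⟩
      0ᴹ                ∎

    -ᴹ‿distribˡ-· : ∀ x y → ((-ᴹ x) · y) ≈ᴹ (-ᴹ (x · y))
    -ᴹ‿distribˡ-· x y = inverseˡ-unique _ _ (begin
      (-ᴹ x) · y +ᴹ x · y   ≈⟨ ≈ᴹ-sym (·-distribʳ y (-ᴹ x) x) ⟩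
      (-ᴹ x +ᴹ x) · y       ≈⟨ ·-cong (-ᴹ‿inverseˡ x) ≈ᴹ-refl ⟩
      0ᴹ · y                ≈⟨ ·-zeroˡ y ⟩
      0ᴹ                    ∎)

  record LinearMap {v ℓv w ℓw} (V : VectorSpace v ℓv) (W : VectorSpace w ℓw)
         : Set (c ⊔ v ⊔ ℓv ⊔ w ⊔ ℓw) where
    private
      module V = Module V
      module W = Module W
    field
      ⟦_⟧      : V.Carrierᴹ → W.Carrierᴹ
      ⟦⟧-cong  : ∀ {x y} → x V.≈ᴹ y → ⟦ x ⟧ W.≈ᴹ ⟦ y ⟧
      +ᴹ-homo  : ∀ x y → ⟦ x V.+ᴹ y ⟧ W.≈ᴹ (⟦ x ⟧ W.+ᴹ ⟦ y ⟧)
      *ₗ-homo  : ∀ r x → ⟦ r V.*ₗ x ⟧ W.≈ᴹ (r W.*ₗ ⟦ x ⟧)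

    open GroupProperties W.+ᴹ-group using (inverseˡ-unique; identityˡ-unique)
    open SetoidReasoning W.≈ᴹ-setoid

    0ᴹ-homo : ⟦ V.0ᴹ ⟧ W.≈ᴹ W.0ᴹ
    0ᴹ-homo = identityˡ-unique _ _ (begin
      ⟦ V.0ᴹ ⟧ W.+ᴹ ⟦ V.0ᴹ ⟧  ≈⟨ W.≈ᴹ-sym (+ᴹ-homo V.0ᴹ V.0ᴹ) ⟩
      ⟦ V.0ᴹ V.+ᴹ V.0ᴹ ⟧      ≈⟨ ⟦⟧-cong (V.+ᴹ-identityˡ V.0ᴹ) ⟩
      ⟦ V.0ᴹ ⟧                ∎)

    -ᴹ-homo : ∀ x → ⟦ V.-ᴹ x ⟧ W.≈ᴹ (W.-ᴹ ⟦ x ⟧)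
    -ᴹ-homo x = inverseˡ-unique _ _ (begin
      ⟦ V.-ᴹ x ⟧ W.+ᴹ ⟦ x ⟧  ≈⟨ W.≈ᴹ-sym (+ᴹ-homo (V.-ᴹ x) x) ⟩
      ⟦ V.-ᴹ x V.+ᴹ x ⟧      ≈⟨ ⟦⟧-cong (V.-ᴹ‿inverseˡ x) ⟩
      ⟦ V.0ᴹ ⟧               ≈⟨ 0ᴹ-homo ⟩
      W.0ᴹ                   ∎)

  open LinearMap

  module TensorEvaluation {a ℓa} (A : KAlgebra a ℓa) {v ℓv} {V : VectorSpace v ℓv} where
    private
      module V = Module V
      module TV = Tensor V
      module A = KAlgebra A
      module TA = Tensor A.vectorSpace
      module PA = KAlgebraProperties A
    open SetoidReasoning A.≈ᴹ-setoid

    ⟪_⊗_⟫ : (f g : LinearMap V A.vectorSpace) → TV.Tensor₂ → A.Carrierᴹ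
    ⟪ f ⊗ g ⟫ t = TA.sumᴹ (map (λ pq → ⟦ f ⟧ (proj₁ pq) A.· ⟦ g ⟧ (proj₂ pq)) t)

    module _ (f g : LinearMap V A.vectorSpace) where

      ⟪⊗⟫-++ : ∀ s t → ⟪ f ⊗ g ⟫ (s ++ t) A.≈ᴹ (⟪ f ⊗ g ⟫ s A.+ᴹ ⟪ f ⊗ g ⟫ t)
      ⟪⊗⟫-++ []      t = A.≈ᴹ-sym (A.+ᴹ-identityˡ _)
      ⟪⊗⟫-++ (_ ∷ s) t = A.≈ᴹ-trans (A.+ᴹ-congˡ (⟪⊗⟫-++ s t)) (A.≈ᴹ-sym (A.+ᴹ-assoc _ _ _))

      ⟪⊗⟫-pure : ∀ {x y} → ⟪ f ⊗ g ⟫ ((x , y) ∷ []) A.≈ᴹ (⟦ f ⟧ x A.· ⟦ g ⟧ y)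
      ⟪⊗⟫-pure = A.+ᴹ-identityʳ _

      ⟪⊗⟫-resp-∼ : ∀ {s t} → s TV.∼₂ t → ⟪ f ⊗ g ⟫ s A.≈ᴹ ⟪ f ⊗ g ⟫ t
      ⟪⊗⟫-resp-∼ TV.∼-refl          = A.≈ᴹ-refl
      ⟪⊗⟫-resp-∼ (TV.∼-sym r)       = A.≈ᴹ-sym (⟪⊗⟫-resp-∼ r)
      ⟪⊗⟫-resp-∼ (TV.∼-trans r r′)  = A.≈ᴹ-trans (⟪⊗⟫-resp-∼ r) (⟪⊗⟫-resp-∼ r′)
      ⟪⊗⟫-resp-∼ (TV.∼-++ {s} {s′} {t} {t′} r r′) = begin
        ⟪ f ⊗ g ⟫ (s ++ t)                    ≈⟨ ⟪⊗⟫-++ s t ⟩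
        ⟪ f ⊗ g ⟫ s A.+ᴹ ⟪ f ⊗ g ⟫ t          ≈⟨ A.+ᴹ-cong (⟪⊗⟫-resp-∼ r) (⟪⊗⟫-resp-∼ r′) ⟩
        ⟪ f ⊗ g ⟫ s′ A.+ᴹ ⟪ f ⊗ g ⟫ t′        ≈⟨ A.≈ᴹ-sym (⟪⊗⟫-++ s′ t′) ⟩
        ⟪ f ⊗ g ⟫ (s′ ++ t′)                  ∎
      ⟪⊗⟫-resp-∼ (TV.∼-swap {s} {t}) = begin
        ⟪ f ⊗ g ⟫ (s ++ t)                    ≈⟨ ⟪⊗⟫-++ s t ⟩
        ⟪ f ⊗ g ⟫ s A.+ᴹ ⟪ f ⊗ g ⟫ t          ≈⟨ A.+ᴹ-comm _ _ ⟩
        ⟪ f ⊗ g ⟫ t A.+ᴹ ⟪ f ⊗ g ⟫ s          ≈⟨ A.≈ᴹ-sym (⟪⊗⟫-++ t s) ⟩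
        ⟪ f ⊗ g ⟫ (t ++ s)                    ∎
      ⟪⊗⟫-resp-∼ (TV.∼-≈ x≈x′ y≈y′) = A.+ᴹ-congʳ (A.·-cong (⟦⟧-cong f x≈x′) (⟦⟧-cong g y≈y′))
      ⟪⊗⟫-resp-∼ (TV.∼-+ˡ {x} {x′} {y}) = begin
        ⟪ f ⊗ g ⟫ ((x V.+ᴹ x′ , y) ∷ [])      ≈⟨ ⟪⊗⟫-pure ⟩
        ⟦ f ⟧ (x V.+ᴹ x′) A.· ⟦ g ⟧ y         ≈⟨ A.·-cong (+ᴹ-homo f x x′) A.≈ᴹ-refl ⟩
        (⟦ f ⟧ x A.+ᴹ ⟦ f ⟧ x′) A.· ⟦ g ⟧ y   ≈⟨ A.·-distribʳ _ _ _ ⟩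
        ⟦ f ⟧ x A.· ⟦ g ⟧ y A.+ᴹ ⟦ f ⟧ x′ A.· ⟦ g ⟧ y
                                              ≈⟨ A.+ᴹ-congˡ (A.≈ᴹ-sym ⟪⊗⟫-pure) ⟩
        ⟪ f ⊗ g ⟫ ((x , y) ∷ (x′ , y) ∷ [])   ∎
      ⟪⊗⟫-resp-∼ (TV.∼-+ʳ {x} {y} {y′}) = begin
        ⟪ f ⊗ g ⟫ ((x , y V.+ᴹ y′) ∷ [])      ≈⟨ ⟪⊗⟫-pure ⟩
        ⟦ f ⟧ x A.· ⟦ g ⟧ (y V.+ᴹ y′)         ≈⟨ A.·-cong A.≈ᴹ-refl (+ᴹ-homo g y y′) ⟩
        ⟦ f ⟧ x A.· (⟦ g ⟧ y A.+ᴹ ⟦ g ⟧ y′)   ≈⟨ A.·-distribˡ _ _ _ ⟩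
        ⟦ f ⟧ x A.· ⟦ g ⟧ y A.+ᴹ ⟦ f ⟧ x A.· ⟦ g ⟧ y′
                                              ≈⟨ A.+ᴹ-congˡ (A.≈ᴹ-sym ⟪⊗⟫-pure) ⟩
        ⟪ f ⊗ g ⟫ ((x , y) ∷ (x , y′) ∷ [])   ∎
      ⟪⊗⟫-resp-∼ (TV.∼-0ˡ {y}) = begin
        ⟪ f ⊗ g ⟫ ((V.0ᴹ , y) ∷ [])           ≈⟨ ⟪⊗⟫-pure ⟩
        ⟦ f ⟧ V.0ᴹ A.· ⟦ g ⟧ y                ≈⟨ A.·-cong (0ᴹ-homo f) A.≈ᴹ-refl ⟩
        A.0ᴹ A.· ⟦ g ⟧ y                      ≈⟨ PA.·-zeroˡ _ ⟩
        A.0ᴹ                                  ∎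
      ⟪⊗⟫-resp-∼ (TV.∼-0ʳ {x}) = begin
        ⟪ f ⊗ g ⟫ ((x , V.0ᴹ) ∷ [])           ≈⟨ ⟪⊗⟫-pure ⟩
        ⟦ f ⟧ x A.· ⟦ g ⟧ V.0ᴹ                ≈⟨ A.·-cong A.≈ᴹ-refl (0ᴹ-homo g) ⟩
        ⟦ f ⟧ x A.· A.0ᴹ                      ≈⟨ PA.·-zeroʳ _ ⟩
        A.0ᴹ                                  ∎
      ⟪⊗⟫-resp-∼ (TV.∼-* {r} {x} {y}) = A.+ᴹ-congʳ (begin
        ⟦ f ⟧ (r V.*ₗ x) A.· ⟦ g ⟧ y          ≈⟨ A.·-cong (*ₗ-homo f r x) A.≈ᴹ-refl ⟩
        (r A.*ₗ ⟦ f ⟧ x) A.· ⟦ g ⟧ y          ≈⟨ A.·-*ₗˡ r _ _ ⟩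
        r A.*ₗ (⟦ f ⟧ x A.· ⟦ g ⟧ y)          ≈⟨ A.≈ᴹ-sym (A.·-*ₗʳ r _ _) ⟩
        ⟦ f ⟧ x A.· (r A.*ₗ ⟦ g ⟧ y)          ≈⟨ A.·-cong A.≈ᴹ-refl (A.≈ᴹ-sym (*ₗ-homo g r y)) ⟩
        ⟦ f ⟧ x A.· ⟦ g ⟧ (r V.*ₗ y)          ∎)

      ⟪⊗⟫-vanishes : ∀ {n} {N : V.Carrierᴹ → Set n} → (∀ x → N x → ⟦ f ⟧ x A.≈ᴹ A.0ᴹ) →
                     ∀ {t} → All (λ pq → N (proj₁ pq)) t → ⟪ f ⊗ g ⟫ t A.≈ᴹ A.0ᴹ
      ⟪⊗⟫-vanishes f|N []                         = A.≈ᴹ-refl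
      ⟪⊗⟫-vanishes f|N {(x , y) ∷ t} (x∈N ∷ t∈N⊗V) = begin
        ⟦ f ⟧ x A.· ⟦ g ⟧ y A.+ᴹ ⟪ f ⊗ g ⟫ t  ≈⟨ A.+ᴹ-cong (A.·-cong (f|N x x∈N) A.≈ᴹ-refl)
                                                          (⟪⊗⟫-vanishes f|N t∈N⊗V) ⟩
        A.0ᴹ A.· ⟦ g ⟧ y A.+ᴹ A.0ᴹ            ≈⟨ A.+ᴹ-identityʳ _ ⟩
        A.0ᴹ A.· ⟦ g ⟧ y                      ≈⟨ PA.·-zeroˡ _ ⟩
        A.0ᴹ                                  ∎

  module _ {m ℓm a ℓa} (H : HopfAlgebra m ℓm) (A : KAlgebra a ℓa) where
    private
      module H = HopfAlgebra H
      module A = KAlgebra A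
      module PA = KAlgebraProperties A
    open TensorEvaluation A
    open GroupProperties A.+ᴹ-group using (x∙y⁻¹≈ε⇒x≈y; ε⁻¹≈ε)
    open SetoidReasoning A.≈ᴹ-setoid

    ⟪⊗⟫-Δ-on : ∀ {n} {N : H.Carrierᴹ → Set n} → ReducedCoproductInto H N →
               (f g : LinearMap H.vectorSpace A.vectorSpace) → VanishesOn H A N ⟦ f ⟧ →
               ∀ x → N x → ⟪ f ⊗ g ⟫ (H.Δ x) A.≈ᴹ (⟦ f ⟧ H.1ᴬ A.· ⟦ g ⟧ x)
    ⟪⊗⟫-Δ-on Δ̃N⊆N⊗H f g f|N x x∈N with Δ̃N⊆N⊗H x x∈N
    ... | t , t∈N⊗H , Δ̃x∼t = x∙y⁻¹≈ε⇒x≈y _ _ (begin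
      ⟪ f ⊗ g ⟫ (H.Δ x) A.+ᴹ A.-ᴹ (⟦ f ⟧ H.1ᴬ A.· ⟦ g ⟧ x)
        ≈⟨ A.+ᴹ-congˡ (A.≈ᴹ-sym unit-terms) ⟩
      ⟪ f ⊗ g ⟫ (H.Δ x) A.+ᴹ ⟪ f ⊗ g ⟫ ((H.-ᴹ H.1ᴬ , x) ∷ (H.-ᴹ x , H.1ᴬ) ∷ [])
        ≈⟨ A.≈ᴹ-sym (⟪⊗⟫-++ f g (H.Δ x) _) ⟩
      ⟪ f ⊗ g ⟫ (H.Δ̃ x)  ≈⟨ ⟪⊗⟫-resp-∼ f g Δ̃x∼t ⟩
      ⟪ f ⊗ g ⟫ t        ≈⟨ ⟪⊗⟫-vanishes f g f|N t∈N⊗H ⟩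
      A.0ᴹ               ∎)
      where
      f-x≈0 : ⟦ f ⟧ (H.-ᴹ x) A.≈ᴹ A.0ᴹ
      f-x≈0 = A.≈ᴹ-trans (-ᴹ-homo f x) (A.≈ᴹ-trans (A.-ᴹ‿cong (f|N x x∈N)) ε⁻¹≈ε)

      unit-terms : ⟪ f ⊗ g ⟫ ((H.-ᴹ H.1ᴬ , x) ∷ (H.-ᴹ x , H.1ᴬ) ∷ [])
                   A.≈ᴹ A.-ᴹ (⟦ f ⟧ H.1ᴬ A.· ⟦ g ⟧ x)
      unit-terms = begin
        ⟦ f ⟧ (H.-ᴹ H.1ᴬ) A.· ⟦ g ⟧ x A.+ᴹ (⟦ f ⟧ (H.-ᴹ x) A.· ⟦ g ⟧ H.1ᴬ A.+ᴹ A.0ᴹ)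
          ≈⟨ A.+ᴹ-cong (A.·-cong (-ᴹ-homo f H.1ᴬ) A.≈ᴹ-refl) (A.+ᴹ-identityʳ _) ⟩
        (A.-ᴹ ⟦ f ⟧ H.1ᴬ) A.· ⟦ g ⟧ x A.+ᴹ ⟦ f ⟧ (H.-ᴹ x) A.· ⟦ g ⟧ H.1ᴬ
          ≈⟨ A.+ᴹ-cong (PA.-ᴹ‿distribˡ-· _ _) (A.·-cong f-x≈0 A.≈ᴹ-refl) ⟩
        A.-ᴹ (⟦ f ⟧ H.1ᴬ A.· ⟦ g ⟧ x) A.+ᴹ A.0ᴹ A.· ⟦ g ⟧ H.1ᴬ
          ≈⟨ A.+ᴹ-congˡ (PA.·-zeroˡ _) ⟩
        A.-ᴹ (⟦ f ⟧ H.1ᴬ A.· ⟦ g ⟧ x) A.+ᴹ A.0ᴹ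
          ≈⟨ A.+ᴹ-identityʳ _ ⟩
        A.-ᴹ (⟦ f ⟧ H.1ᴬ A.· ⟦ g ⟧ x) ∎

    convUnit-vanishesOn : ∀ {n} {N : H.Carrierᴹ → Set n} → (∀ x → N x → H.ε x ≈ 0#) →
                          VanishesOn H A N (convUnit H A)
    convUnit-vanishesOn ε|N x x∈N = A.≈ᴹ-trans (A.*ₗ-congʳ (ε|N x x∈N)) (A.*ₗ-zeroˡ A.1ᴬ)

    convolution-vanishesOn : ∀ {n} {N : H.Carrierᴹ → Set n} → ReducedCoproductInto H N →
                             (f g : LinearMap H.vectorSpace A.vectorSpace) →
                             VanishesOn H A N ⟦ f ⟧ → VanishesOn H A N ⟦ g ⟧ →
                             VanishesOn H A N (convolution H A ⟦ f ⟧ ⟦ g ⟧)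
    convolution-vanishesOn Δ̃N⊆N⊗H f g f|N g|N x x∈N = begin
      ⟪ f ⊗ g ⟫ (H.Δ x)         ≈⟨ ⟪⊗⟫-Δ-on Δ̃N⊆N⊗H f g f|N x x∈N ⟩
      ⟦ f ⟧ H.1ᴬ A.· ⟦ g ⟧ x    ≈⟨ A.·-cong A.≈ᴹ-refl (g|N x x∈N) ⟩
      ⟦ f ⟧ H.1ᴬ A.· A.0ᴹ       ≈⟨ PA.·-zeroʳ _ ⟩
      A.0ᴹ                      ∎

    linear : AlgMorphism H A → LinearMap H.vectorSpace A.vectorSpace
    linear φ = record { ⟦_⟧ = f ; ⟦⟧-cong = f-cong ; +ᴹ-homo = f-+ ; *ₗ-homo = f-*ₗ }
      where open AlgMorphism φ

    linear∘S : AlgMorphism H A → LinearMap H.vectorSpace A.vectorSpace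
    linear∘S φ = record
      { ⟦_⟧     = λ x → f (H.S x)
      ; ⟦⟧-cong = λ x≈y → f-cong (H.S-cong x≈y)
      ; +ᴹ-homo = λ x y → A.≈ᴹ-trans (f-cong (H.S-+ x y)) (f-+ _ _)
      ; *ₗ-homo = λ r x → A.≈ᴹ-trans (f-cong (H.S-*ₗ r x)) (f-*ₗ r _)
      }
      where open AlgMorphism φ

    ⟪⊗∘S⟫-homo : (φ : AlgMorphism H A) → ∀ t →
                 ⟪ linear φ ⊗ linear∘S φ ⟫ t
                 A.≈ᴹ AlgMorphism.f φ (H.sumᴹ (map (λ pq → proj₁ pq H.· H.S (proj₂ pq)) t))
    ⟪⊗∘S⟫-homo φ []            = A.≈ᴹ-sym (0ᴹ-homo (linear φ))
    ⟪⊗∘S⟫-homo φ ((p , q) ∷ t) = begin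
      f p A.· f (H.S q) A.+ᴹ ⟪ linear φ ⊗ linear∘S φ ⟫ t
        ≈⟨ A.+ᴹ-cong (A.≈ᴹ-sym (f-· p (H.S q))) (⟪⊗∘S⟫-homo φ t) ⟩
      f (p H.· H.S q) A.+ᴹ f (H.sumᴹ (map (λ pq → proj₁ pq H.· H.S (proj₂ pq)) t))
        ≈⟨ A.≈ᴹ-sym (f-+ _ _) ⟩
      f (H.sumᴹ (map (λ pq → proj₁ pq H.· H.S (proj₂ pq)) ((p , q) ∷ t))) ∎
      where open AlgMorphism φ

    convInverse-vanishesOn : ∀ {n} {N : H.Carrierᴹ → Set n} → (∀ x → N x → H.ε x ≈ 0#) →
                             ReducedCoproductInto H N → (φ : AlgMorphism H A) → InT H A N φ →
                             VanishesOn H A N (convInverse H A (AlgMorphism.f φ))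
    convInverse-vanishesOn ε|N Δ̃N⊆N⊗H φ φ|N x x∈N = begin
      f (H.S x)                              ≈⟨ A.≈ᴹ-sym (A.·-identityˡ _) ⟩
      A.1ᴬ A.· f (H.S x)                     ≈⟨ A.·-cong (A.≈ᴹ-sym f-1) A.≈ᴹ-refl ⟩
      f H.1ᴬ A.· f (H.S x)                   ≈⟨ A.≈ᴹ-sym (⟪⊗⟫-Δ-on Δ̃N⊆N⊗H (linear φ) (linear∘S φ) φ|N x x∈N) ⟩
      ⟪ linear φ ⊗ linear∘S φ ⟫ (H.Δ x)      ≈⟨ ⟪⊗∘S⟫-homo φ (H.Δ x) ⟩
      f (H.sumᴹ (map (λ pq → proj₁ pq H.· H.S (proj₂ pq)) (H.Δ x)))
                                             ≈⟨ f-cong (H.antipodeʳ x) ⟩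
      f (H.ε x H.*ₗ H.1ᴬ)                    ≈⟨ f-cong (H.*ₗ-congʳ (ε|N x x∈N)) ⟩
      f (0# H.*ₗ H.1ᴬ)                       ≈⟨ f-cong (H.*ₗ-zeroˡ H.1ᴬ) ⟩
      f H.0ᴹ                                 ≈⟨ 0ᴹ-homo (linear φ) ⟩
      A.0ᴹ                                   ∎
      where open AlgMorphism φ

open Characters

lemma3p1 : ∀ {c ℓ m ℓm p n a ℓa} (K : Field c ℓ) → CharacteristicZero K →
    (H : Over.HopfAlgebra K m ℓm) → Over.ConnectedFiltered K H p →
    (N : Over.HopfAlgebra.Carrierᴹ H → Set n) →
    Over.IsSubspace K (Over.HopfAlgebra.vectorSpace H) N →
    (∀ x → N x → Field._≈_ K (Over.HopfAlgebra.ε H x) (Field.0# K)) →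
    Over.ReducedCoproductInto K H N →
    (A : Over.KAlgebra K a ℓa) → Over.IsCommutative K A →
    Over.VanishesOn K H A N (Over.convUnit K H A)
    × (∀ (φ ψ : Over.AlgMorphism K H A) → Over.InT K H A N φ → Over.InT K H A N ψ →
         Over.VanishesOn K H A N
           (Over.convolution K H A (Over.AlgMorphism.f φ) (Over.AlgMorphism.f ψ)))
    × (∀ (φ : Over.AlgMorphism K H A) → Over.InT K H A N φ →
         Over.VanishesOn K H A N (Over.convInverse K H A (Over.AlgMorphism.f φ)))
lemma3p1 K _ H _ N _ ε|N Δ̃N⊆N⊗H A _ =
    convUnit-vanishesOn K H A ε|N
  , (λ φ ψ → convolution-vanishesOn K H A Δ̃N⊆N⊗H (linear K H A φ) (linear K H A ψ))
  , convInverse-vanishesOn K H A ε|N Δ̃N⊆N⊗H
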